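{- Let $t\ge 3$ be an integer and let $W$ be a symmetric $(4t,4(t-1))$-weighing matrix whose diagonal $4\times 4$ blocks are all zero. Let $W'$ be the $8t\times 8t$ matrix obtained from $W$ by replacing each entry $0$ by $O_2$, each $1$ by $I_2$, and each $-1$ by $J_2-I_2$, and let $$M_0=I_{8t},\ M_1=I_{4t}\otimes(J_2-I_2),\ M_2=I_t\otimes\big((J_4-I_4)\otimes J_2\big),\ M_3=W',\ M_4=J_{8t}-M_0-M_1-M_2-M_3.$$ For a $\{0,1\}$-matrix $M$ indexed by $V=\{1,\dots,8t\}$ put $s(M)=\{(x,y)\in V^2:M_{xy}=1\}$. Then $\mathcal{X}=(V,\{s(M_i):i\in\{0,\dots,4\}\})$ is a Higmanian association scheme.
   Context: An $(n,k)$-weighing matrix is an $n\times n$ $\{0,1,-1\}$-matrix $W$ with $WW^T=kI_n$; $I_n,J_n,O_n$ are the identity, all-ones and zero matrices; $\otimes$ is the Kronecker product. An association scheme on $V$ is a partition $S$ of $V^2$ containing the diagonal $\mathbf{1}_V$, closed under $s\mapsto s^*=\{(y,x):(x,y)\in s\}$, such that for $r,s,t\in S$ the number $|\{z:(x,z)\in r,(z,y)\in s\}|$ does not depend on $(x,y)\in t$. A parabolic is an equivalence relation on $V$ which is a union of elements of $S$. For $s\subseteq V^2$, $\mathrm{rad}(s)$ is the largest relation $r\subseteq V^2$ with $rs=sr=s$ (composition). The scheme is Higmanian if $|S|=5$, $s^*=s$ for all $s\in S$, there exist $s_1,s_2\in S$ such that $e_0=\mathbf{1}_V\cup s_1$ and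 $e_1=\mathbf{1}_V\cup s_1\cup s_2$ are parabolics, and $\mathrm{rad}(s)=\mathbf{1}_V$ for every $s\in S$ not contained in $e_1$. -}

module Defs where

open import Data.Nat as ℕ using (ℕ; zero; suc; _∸_)
open import Data.Nat.Properties using (*-assoc)
open import Data.Integer as ℤ using (ℤ; +_; -[1+_]; 0ℤ; 1ℤ; -1ℤ)
open import Data.Fin using (Fin; remQuot; cast; zero; suc)
open import Data.Fin.Properties using () renaming (_≟_ to _≟F_)
open import Data.Bool using (Bool; true; false; _∧_; _∨_)
open import Data.List using (List; allFin; filter; length)
open import Data.Bool.ListAction using (any)
open import Data.Product using (Σ; ∃; _×_; _,_; proj₁; proj₂)
open import Relation.Binary.PropositionalEquality using (_≡_)
open import Relation.Nullary using (¬_; does)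
open import Function.Bundles using (_⇔_)

Mat : ℕ → Set
Mat n = Fin n → Fin n → ℤ

ΣFin : (n : ℕ) → (Fin n → ℤ) → ℤ
ΣFin zero    f = 0ℤ
ΣFin (suc n) f = f zero ℤ.+ ΣFin n (λ i → f (suc i))

δ : {n : ℕ} → Fin n → Fin n → ℤ
δ i j with does (i ≟F j)
... | true  = 1ℤ
... | false = 0ℤ

Iₘ : (n : ℕ) → Mat n
Iₘ n = δ

Jₘ : (n : ℕ) → Mat n
Jₘ n i j = 1ℤ

Oₘ : (n : ℕ) → Mat n
Oₘ n i j = 0ℤ

_-ₘ_ : {n : ℕ} → Mat n → Mat n → Mat n
(A -ₘ B) i j = A i j ℤ.- B i j

-- Kronecker product; index of (i,k) in Fin (n * m) is i * m + k
_⊗_ : {n m : ℕ} → Mat n → Mat m → Mat (n ℕ.* m)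
_⊗_ {n} {m} A B x y =
  A (proj₁ (remQuot {n} m x)) (proj₁ (remQuot {n} m y)) ℤ.* B (proj₂ (remQuot {n} m x)) (proj₂ (remQuot {n} m y))

castMat : {n m : ℕ} → .(m ≡ n) → Mat n → Mat m
castMat eq A x y = A (cast eq x) (cast eq y)

IsTernary : {n : ℕ} → Mat n → Set
IsTernary {n} W = ∀ i j → (W i j ≡ 0ℤ) Data.Sum.⊎ ((W i j ≡ 1ℤ) Data.Sum.⊎ (W i j ≡ -1ℤ))
  where import Data.Sum

IsWeighing : (n k : ℕ) → Mat n → Set
IsWeighing n k W =
  IsTernary W × (∀ i j → ΣFin n (λ l → W i l ℤ.* W j l) ≡ (+ k) ℤ.* δ i j)

IsSymmetricMat : {n : ℕ} → Mat n → Set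
IsSymmetricMat W = ∀ i j → W i j ≡ W j i

DiagBlocksZero : (t : ℕ) → Mat (t ℕ.* 4) → Set
DiagBlocksZero t W =
  ∀ i j → proj₁ (remQuot 4 i) ≡ proj₁ (remQuot {t} 4 j) → W i j ≡ 0ℤ

-- block replacing an entry: 0 ↦ O₂, 1 ↦ I₂, -1 ↦ J₂ - I₂
-- (other values do not occur for weighing matrices; mapped to O₂)
block : ℤ → Mat 2
block (+ 1)      = Iₘ 2
block -[1+ 0 ]   = Jₘ 2 -ₘ Iₘ 2
block _          = Oₘ 2

expand : {n : ℕ} → Mat n → Mat (n ℕ.* 2)
expand {n} W x y =
  block (W (proj₁ (remQuot {n} 2 x)) (proj₁ (remQuot {n} 2 y))) (proj₂ (remQuot {n} 2 x)) (proj₂ (remQuot {n} 2 y))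

-- V = {1,…,8t} is represented by Fin (t * 4 * 2)
M : (t : ℕ) → Mat (t ℕ.* 4) → Fin 5 → Mat (t ℕ.* 4 ℕ.* 2)
M t W zero = Iₘ _
M t W (suc zero) = Iₘ (t ℕ.* 4) ⊗ (Jₘ 2 -ₘ Iₘ 2)
M t W (suc (suc zero)) = castMat (*-assoc t 4 2) (Iₘ t ⊗ ((Jₘ 4 -ₘ Iₘ 4) ⊗ Jₘ 2))
M t W (suc (suc (suc zero))) = expand W
M t W (suc (suc (suc (suc zero)))) =
  ((((Jₘ _ -ₘ M t W zero) -ₘ M t W (suc zero)) -ₘ M t W (suc (suc zero))) -ₘ M t W (suc (suc (suc zero))))

Rel : ℕ → Set
Rel N = Fin N → Fin N → Bool

sOf : {N : ℕ} → Mat N → Rel N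
sOf A x y = does (A x y ℤ.≟ 1ℤ)

diag : {N : ℕ} → Rel N
diag x y = does (x ≟F y)

_∪_ : {N : ℕ} → Rel N → Rel N → Rel N
(r ∪ s) x y = r x y ∨ s x y

_⊆_ : {N : ℕ} → Rel N → Rel N → Set
r ⊆ s = ∀ x y → r x y ≡ true → s x y ≡ true

_≐_ : {N : ℕ} → Rel N → Rel N → Set
r ≐ s = ∀ x y → r x y ≡ s x y

_∘ᵣ_ : {N : ℕ} → Rel N → Rel N → Rel N
_∘ᵣ_ {N} r s x y = any (λ z → r x z ∧ s z y) (allFin N)

countV : (N : ℕ) → (Fin N → Bool) → ℕ
countV N p = length (filter (λ z → Data.Bool._≟_ (p z) true) (allFin N))
  where import Data.Bool

-- Association schemes: the family R : Fin d → Rel N is the set S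
-- (a partition of V² into d nonempty, hence pairwise distinct, classes)

record IsAssociationScheme {N d : ℕ} (R : Fin d → Rel N) : Set where
  field
    covers      : ∀ x y → ∃ λ i → R i x y ≡ true
    disjoint    : ∀ i j x y → R i x y ≡ true → R j x y ≡ true → i ≡ j
    nonempty    : ∀ i → ∃ λ x → ∃ λ y → R i x y ≡ true
    hasDiagonal : ∃ λ i → R i ≐ diag
    closedTrans : ∀ i → ∃ λ j → ∀ x y → R j x y ≡ R i y x
    intersection : ∀ i j k → ∃ λ (p : ℕ) → ∀ x y → R k x y ≡ true →
                     countV N (λ z → R i x z ∧ R j z y) ≡ p

record IsParabolic {N d : ℕ} (R : Fin d → Rel N) (e : Rel N) : Set where
  field
    refl′  : ∀ x → e x x ≡ true
    sym′   : ∀ x y → e x y ≡ true → e y x ≡ true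
    trans′ : ∀ x y z → e x y ≡ true → e y z ≡ true → e x z ≡ true
    union  : ∃ λ (T : Fin d → Bool) →
               ∀ x y → (e x y ≡ true) ⇔ (∃ λ i → T i ≡ true × R i x y ≡ true)

-- rad(s) = 1_V : 1_V is the largest relation r with rs = sr = s
-- (1_V always satisfies this, so it says every such r is contained in 1_V)
RadIsDiagonal : {N : ℕ} → Rel N → Set
RadIsDiagonal {N} s = ∀ (r : Rel N) → (r ∘ᵣ s) ≐ s → (s ∘ᵣ r) ≐ s → r ⊆ diag

IsHigmanian : {N : ℕ} → (Fin 5 → Rel N) → Set
IsHigmanian {N} R =
  IsAssociationScheme R ×
  (∀ i x y → R i x y ≡ R i y x) ×
  (∃ λ s₁ → ∃ λ s₂ →
     IsParabolic R (diag ∪ R s₁) ×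
     IsParabolic R ((diag ∪ R s₁) ∪ R s₂) ×
     (∀ s → ¬ (R s ⊆ ((diag ∪ R s₁) ∪ R s₂)) → RadIsDiagonal (R s)))

module Submission where

-- Index V by (row, bit), a row being (group, slot) ∈ t × 4.  With K₂ = 2I₂ − J₂, the five
-- Kronecker products B₀ = I ⊗ I₂, B₁ = I ⊗ J₂, B₂ = (Iₜ ⊗ J₄) ⊗ J₂, B₃ = J ⊗ J₂, B₄ = W ⊗ K₂
-- satisfy 2Mᵢ = Σᵤ αᵢᵤ Bᵤ; for M₃ and M₄ this needs the off-block entries of W to be ±1, which the
-- row weight 4(t − 1) and the zero diagonal blocks force.  The values of B₀, …, B₄ at a pair (x, y)
-- form one of five profiles βₖ, and on profile k that identity gives Mᵢ = δᵢₖ, so the classes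
-- s(Mₖ) partition V² and are exactly the profiles.  By the mixed-product rule, J₂K₂ = K₂J₂ = 0,
-- K₂² = 2K₂ and W² = 4(t − 1)I, every product BᵤBᵥ is a multiple of some B_w or of I ⊗ K₂ = 2B₀ − B₁,
-- hence constant on classes; so is 4MᵢMⱼ, which gives the intersection numbers.  The parabolics
-- are "same row" and "same group".  For the classes 3 and 4 and points x ≠ w there is a y adjacent
-- to w but not to x (inside a group, by the orthogonality of the rows of x and w), so their
-- radicals are trivial.

open import Defs
open import Data.Nat as ℕ using (ℕ; zero; suc; _∸_; _≤_; s≤s; z≤n)
import Data.Nat.Properties as ℕP
open import Data.Nat.Tactic.RingSolver as ℕSolver using ()
open import Data.Integer as ℤ using (ℤ; +_; 0ℤ; 1ℤ; -1ℤ; _+_; _*_; -_; _-_)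
import Data.Integer.Properties as ℤP
open import Data.Integer.Tactic.RingSolver using (solve-∀)
open import Data.Fin using (Fin; zero; suc; combine; remQuot; quotient; remainder; cast; toℕ; _↑ˡ_; _↑ʳ_)
open import Data.Fin.Properties
  using (all?; ¬∀⟶∃¬; combine-injectiveʳ; remQuot-combine; combine-remQuot; toℕ-combine; toℕ-cast; toℕ-injective)
  renaming (_≟_ to _≟F_)
open import Data.Fin.Patterns using (0F; 1F; 2F; 3F; 4F)
open import Data.Bool using (Bool; true; false; _∧_; _∨_)
import Data.Bool
open import Data.Bool.ListAction using (any)
open import Data.Bool.Properties using (T-≡; ∨-zeroʳ)
open import Data.List using (allFin; filter; length; tabulate)
open import Data.Product using (∃; ∃₂; _×_; _,_; proj₁; proj₂; uncurry)
open import Data.Sum using (_⊎_; inj₁; inj₂)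
open import Function using (_∘_; _⇔_; mk⇔; Equivalence)
open import Data.Vec.Functional using ([]; _∷_)
open import Relation.Binary.PropositionalEquality
open import Data.List.Relation.Unary.Any.Properties using (any⁺)
open import Data.List.Membership.Propositional using (lose)
open import Data.List.Membership.Propositional.Properties using (∈-allFin)
open import Relation.Nullary using (¬_; Dec; does; yes; no; contradiction)
open import Relation.Nullary.Decidable using (True; toWitness; dec-true; ¬?; _→-dec_)
open import Algebra.Properties.Semiring.Sum ℤP.+-*-semiring
  using (sum-syntax; sum-cong-≗; sum-replicate-zero; *-distribˡ-sum; *-distribʳ-sum; ∑-comm)
open import Algebra.Properties.CommutativeSemigroup ℤP.*-commutativeSemigroup
  using (interchange)

private variable
  m n k : ℕ
  A : Set

∑-const : ∀ n c → ∑[ i < n ] c ≡ + n * c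
∑-const zero    c = sym (ℤP.*-zeroˡ c)
∑-const (suc n) c = trans (cong (_+_ c) (∑-const n c)) (lemma c (+ n))
  where lemma : ∀ c m → c + m * c ≡ (1ℤ + m) * c
        lemma = solve-∀

ΣFin≡∑ : ∀ n (f : Fin n → ℤ) → ΣFin n f ≡ ∑[ i < n ] f i
ΣFin≡∑ zero    f = refl
ΣFin≡∑ (suc n) f = cong (_+_ (f zero)) (ΣFin≡∑ n (f ∘ suc))

∑-++ : ∀ m n (f : Fin (m ℕ.+ n) → ℤ) →
       ∑[ i < m ℕ.+ n ] f i ≡ ∑[ i < m ] f (i ↑ˡ n) + ∑[ j < n ] f (m ↑ʳ j)
∑-++ zero    n f = sym (ℤP.+-identityˡ _)
∑-++ (suc m) n f = trans (cong (_+_ (f zero)) (∑-++ m n (f ∘ suc))) (sym (ℤP.+-assoc (f zero) _ _))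

∑-combine : ∀ m n (f : Fin (m ℕ.* n) → ℤ) →
            ∑[ k < m ℕ.* n ] f k ≡ ∑[ i < m ] ∑[ j < n ] f (combine i j)
∑-combine zero    n f = refl
∑-combine (suc m) n f =
  trans (∑-++ n (m ℕ.* n) f)
        (cong (_+_ (∑[ j < n ] f (j ↑ˡ m ℕ.* n))) (∑-combine m n (λ k → f (n ↑ʳ k))))

∑-remQuot : ∀ m n (F : Fin m → Fin n → ℤ) →
            ∑[ k < m ℕ.* n ] F (quotient n k) (remainder {m} n k) ≡ ∑[ i < m ] ∑[ j < n ] F i j
∑-remQuot m n F = trans (∑-combine m n _)
  (sum-cong-≗ λ i → sum-cong-≗ λ j → cong (uncurry F) (remQuot-combine i j))

∑-distrib-sub : (f g : Fin n → ℤ) → ∑[ i < n ] (f i - g i) ≡ ∑[ i < n ] f i - ∑[ i < n ] g i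
∑-distrib-sub {zero}  f g = refl
∑-distrib-sub {suc n} f g =
  trans (cong (_+_ (f zero - g zero)) (∑-distrib-sub (f ∘ suc) (g ∘ suc))) (regroup (f zero) (g zero) _ _)
  where regroup : ∀ a b c d → (a - b) + (c - d) ≡ (a + c) - (b + d)
        regroup = solve-∀

∑-nonneg : (f : Fin n → ℤ) → (∀ i → 0ℤ ℤ.≤ f i) → 0ℤ ℤ.≤ ∑[ i < n ] f i
∑-nonneg {zero}  f f≥0 = ℤP.≤-refl
∑-nonneg {suc n} f f≥0 = ℤP.+-mono-≤ (f≥0 zero) (∑-nonneg (f ∘ suc) (f≥0 ∘ suc))

nonneg-+-zero : ∀ {a b} → 0ℤ ℤ.≤ a → 0ℤ ℤ.≤ b → a + b ≡ 0ℤ → a ≡ 0ℤ × b ≡ 0ℤ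
nonneg-+-zero {a} {b} a≥0 b≥0 a+b≡0 = ℤP.≤-antisym a≤0 a≥0 , ℤP.≤-antisym b≤0 b≥0
  where
  a≤0 = subst₂ ℤ._≤_ (ℤP.+-identityʳ a) a+b≡0 (ℤP.+-monoʳ-≤ a b≥0)
  b≤0 = subst₂ ℤ._≤_ (ℤP.+-identityˡ b) a+b≡0 (ℤP.+-monoˡ-≤ b a≥0)

∑-nonneg-zero : (f : Fin n → ℤ) → (∀ i → 0ℤ ℤ.≤ f i) → ∑[ i < n ] f i ≡ 0ℤ → ∀ i → f i ≡ 0ℤ
∑-nonneg-zero {suc n} f f≥0 ∑≡0 zero    = proj₁ (nonneg-+-zero (f≥0 zero) (∑-nonneg (f ∘ suc) (f≥0 ∘ suc)) ∑≡0)
∑-nonneg-zero {suc n} f f≥0 ∑≡0 (suc i) =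
  ∑-nonneg-zero (f ∘ suc) (f≥0 ∘ suc) (proj₂ (nonneg-+-zero (f≥0 zero) (∑-nonneg (f ∘ suc) (f≥0 ∘ suc)) ∑≡0)) i

δ-≡ : {i j : Fin n} → i ≡ j → δ i j ≡ 1ℤ
δ-≡ {i = i} {j} i≡j with i ≟F j
... | yes _   = refl
... | no i≢j = contradiction i≡j i≢j

δ-≢ : {i j : Fin n} → i ≢ j → δ i j ≡ 0ℤ
δ-≢ {i = i} {j} i≢j with i ≟F j
... | yes i≡j = contradiction i≡j i≢j
... | no _    = refl

δ-refl : (i : Fin n) → δ i i ≡ 1ℤ
δ-refl i = δ-≡ {i = i} refl

δ≡1⇒≡ : {i j : Fin n} → δ i j ≡ 1ℤ → i ≡ j
δ≡1⇒≡ {i = i} {j} δ≡1 with i ≟F j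
... | yes i≡j = i≡j
... | no _    = contradiction δ≡1 λ ()

δ≡0⇒≢ : {i j : Fin n} → δ i j ≡ 0ℤ → i ≢ j
δ≡0⇒≢ {i = i} δ≡0 refl = contradiction (trans (sym (δ-refl i)) δ≡0) λ ()

δ-sym : (i j : Fin n) → δ i j ≡ δ j i
δ-sym i j with i ≟F j
... | yes refl = sym (δ-refl i)
... | no i≢j   = sym (δ-≢ (i≢j ∘ sym))

δ-binary : (i j : Fin n) → δ i j ≡ 0ℤ ⊎ δ i j ≡ 1ℤ
δ-binary i j with i ≟F j
... | yes _ = inj₂ refl
... | no _  = inj₁ refl

∑-δ : (i : Fin n) (f : Fin n → ℤ) → ∑[ k < n ] (δ i k * f k) ≡ f i
∑-δ {suc n} zero    f = begin
  δ {suc n} zero zero * f zero + ∑[ k < n ] (δ {suc n} zero (suc k) * f (suc k))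
    ≡⟨ cong₂ _+_ (cong (_* f zero) (δ-refl {suc n} zero))
                 (sum-cong-≗ λ k → cong (_* f (suc k)) (δ-≢ {i = zero} {suc k} λ ())) ⟩
  1ℤ * f zero + ∑[ k < n ] 0ℤ
    ≡⟨ cong₂ _+_ (ℤP.*-identityˡ (f zero)) (sum-replicate-zero n) ⟩
  f zero + 0ℤ
    ≡⟨ ℤP.+-identityʳ (f zero) ⟩
  f zero ∎
  where open ≡-Reasoning
∑-δ {suc n} (suc i) f =
  trans (cong (λ d → d * f zero + ∑[ k < n ] (δ i k * f (suc k))) (δ-≢ {i = suc i} {zero} λ ()))
        (trans (ℤP.+-identityˡ _) (∑-δ i (f ∘ suc)))

remQuot-injective : (x y : Fin (m ℕ.* n)) → remQuot {m} n x ≡ remQuot n y → x ≡ y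
remQuot-injective {m} {n} x y eq =
  trans (sym (combine-remQuot {m} n x)) (trans (cong (uncurry combine) eq) (combine-remQuot {m} n y))

Iₘ-⊗ : (x y : Fin (m ℕ.* n)) → Iₘ (m ℕ.* n) x y ≡ (Iₘ m ⊗ Iₘ n) x y
Iₘ-⊗ {m} {n} x y = split (x ≟F y) (q ≟F q') (r ≟F r')
  where
  q = quotient {m} n x
  q' = quotient {m} n y
  r = remainder {m} n x
  r' = remainder {m} n y
  split : Dec (x ≡ y) → Dec (q ≡ q') → Dec (r ≡ r') → δ x y ≡ δ q q' * δ r r'
  split (yes x≡y) _         _         =
    trans (δ-≡ x≡y) (sym (cong₂ _*_ (δ-≡ (cong (quotient {m} n) x≡y)) (δ-≡ (cong (remainder {m} n) x≡y))))
  split (no x≢y)  (no q≢q') _         = trans (δ-≢ x≢y) (sym (cong (_* δ r r') (δ-≢ q≢q')))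
  split (no x≢y)  (yes q≡q') (no r≢r') = trans (δ-≢ x≢y) (sym (cong₂ _*_ (δ-≡ q≡q') (δ-≢ r≢r')))
  split (no x≢y)  (yes q≡q') (yes r≡r') = contradiction (remQuot-injective x y (cong₂ _,_ q≡q' r≡r')) x≢y

infixl 7 _*ₘ_
_*ₘ_ : Mat n → Mat n → Mat n
(A *ₘ B) i j = ∑[ k < _ ] (A i k * B k j)

infix 4 _*ₘ_≡ₘ_·_
record _*ₘ_≡ₘ_·_ (A B : Mat n) (c : ℤ) (C : Mat n) : Set where
  constructor pointwise
  field at : ∀ i j → (A *ₘ B) i j ≡ c * C i j
open _*ₘ_≡ₘ_·_

*ₘ-≡ₘ-refl : (A B : Mat n) → A *ₘ B ≡ₘ 1ℤ · (A *ₘ B)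
*ₘ-≡ₘ-refl A B = pointwise λ i j → sym (ℤP.*-identityˡ ((A *ₘ B) i j))

*ₘ-identityˡ : (A : Mat n) → Iₘ n *ₘ A ≡ₘ 1ℤ · A
*ₘ-identityˡ A = pointwise λ i j → trans (∑-δ i (λ k → A k j)) (sym (ℤP.*-identityˡ (A i j)))

*ₘ-identityʳ : (A : Mat n) → A *ₘ Iₘ n ≡ₘ 1ℤ · A
*ₘ-identityʳ A = pointwise λ i j →
  trans (sum-cong-≗ λ k → trans (ℤP.*-comm (A i k) (δ k j)) (cong (_* A i k) (δ-sym k j)))
        (at (*ₘ-identityˡ (λ j i → A i j)) j i)

Jₘ-*ₘ-Jₘ : ∀ n → Jₘ n *ₘ Jₘ n ≡ₘ + n · Jₘ n
Jₘ-*ₘ-Jₘ n = pointwise λ i j → ∑-const n 1ℤ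

*ₘ-bilinear : (a b : Fin k → ℤ) (F G : Fin k → Mat n) (x y : Fin n) →
  ((λ x z → ∑[ u < k ] (a u * F u x z)) *ₘ (λ z y → ∑[ v < k ] (b v * G v z y))) x y ≡
  ∑[ u < k ] ∑[ v < k ] ((a u * b v) * (F u *ₘ G v) x y)
*ₘ-bilinear {k} {n} a b F G x y = begin
  ∑[ z < n ] (∑[ u < k ] (a u * F u x z) * ∑[ v < k ] (b v * G v z y))
    ≡⟨ sum-cong-≗ (λ z → trans (*-distribʳ-sum (∑[ v < k ] (b v * G v z y)) (λ u → a u * F u x z))
                              (sum-cong-≗ λ u → *-distribˡ-sum (a u * F u x z) (λ v → b v * G v z y))) ⟩
  ∑[ z < n ] ∑[ u < k ] ∑[ v < k ] ((a u * F u x z) * (b v * G v z y))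
    ≡⟨ ∑-comm (λ z u → ∑[ v < k ] ((a u * F u x z) * (b v * G v z y))) ⟩
  ∑[ u < k ] ∑[ z < n ] ∑[ v < k ] ((a u * F u x z) * (b v * G v z y))
    ≡⟨ sum-cong-≗ (λ u → ∑-comm (λ z v → (a u * F u x z) * (b v * G v z y))) ⟩
  ∑[ u < k ] ∑[ v < k ] ∑[ z < n ] ((a u * F u x z) * (b v * G v z y))
    ≡⟨ sum-cong-≗ (λ u → sum-cong-≗ λ v →
         trans (sum-cong-≗ λ z → interchange (a u) (F u x z) (b v) (G v z y))
               (sym (*-distribˡ-sum (a u * b v) (λ z → F u x z * G v z y)))) ⟩
  ∑[ u < k ] ∑[ v < k ] ((a u * b v) * (F u *ₘ G v) x y) ∎
  where open ≡-Reasoning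

⊗-*ₘ : (A A' : Mat m) (G G' : Mat n) (x y : Fin (m ℕ.* n)) →
       ((A ⊗ G) *ₘ (A' ⊗ G')) x y ≡
       (A *ₘ A') (quotient n x) (quotient n y) * (G *ₘ G') (remainder {m} n x) (remainder {m} n y)
⊗-*ₘ {m} {n} A A' G G' x y = begin
  ∑[ z < m ℕ.* n ] ((A ⊗ G) x z * (A' ⊗ G') z y)
    ≡⟨ ∑-remQuot m n (λ i j → (A p i * G b j) * (A' i p' * G' j b')) ⟩
  ∑[ i < m ] ∑[ j < n ] ((A p i * G b j) * (A' i p' * G' j b'))
    ≡⟨ sum-cong-≗ (λ i → sum-cong-≗ λ j → interchange (A p i) (G b j) (A' i p') (G' j b')) ⟩
  ∑[ i < m ] ∑[ j < n ] ((A p i * A' i p') * (G b j * G' j b'))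
    ≡⟨ sum-cong-≗ (λ i → sym (*-distribˡ-sum (A p i * A' i p') (λ j → G b j * G' j b'))) ⟩
  ∑[ i < m ] ((A p i * A' i p') * (G *ₘ G') b b')
    ≡⟨ sym (*-distribʳ-sum ((G *ₘ G') b b') (λ i → A p i * A' i p')) ⟩
  (A *ₘ A') p p' * (G *ₘ G') b b' ∎
  where
  open ≡-Reasoning
  p = quotient n x
  p' = quotient n y
  b = remainder {m} n x
  b' = remainder {m} n y

⊗-*ₘ-≡ₘ : {A A' C : Mat m} {G G' H : Mat n} {a g : ℤ} →
          A *ₘ A' ≡ₘ a · C → G *ₘ G' ≡ₘ g · H → (A ⊗ G) *ₘ (A' ⊗ G') ≡ₘ (a * g) · (C ⊗ H)
⊗-*ₘ-≡ₘ {A = A} {A'} {C} {G} {G'} {H} {a} {g} AA' GG' = pointwise λ x y →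
  trans (⊗-*ₘ A A' G G' x y) (trans (cong₂ _*_ (at AA' _ _) (at GG' _ _)) (interchange a _ g _))

⊗-symmetric : {A : Mat m} {G : Mat n} → IsSymmetricMat A → IsSymmetricMat G → IsSymmetricMat (A ⊗ G)
⊗-symmetric A-sym G-sym x y = cong₂ _*_ (A-sym _ _) (G-sym _ _)

Iₘ-symmetric : IsSymmetricMat (Iₘ n)
Iₘ-symmetric = δ-sym

Jₘ-symmetric : IsSymmetricMat (Jₘ n)
Jₘ-symmetric i j = refl

cast-*-assoc-combine : (g : Fin m) (a : Fin n) (b : Fin k) →
                       cast (ℕP.*-assoc m n k) (combine (combine g a) b) ≡ combine g (combine a b)
cast-*-assoc-combine {m} {n} {k} g a b = toℕ-injective (begin
  toℕ (cast (ℕP.*-assoc m n k) (combine (combine g a) b)) ≡⟨ toℕ-cast (ℕP.*-assoc m n k) _ ⟩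
  toℕ (combine (combine g a) b)                           ≡⟨ toℕ-combine (combine g a) b ⟩
  k ℕ.* toℕ (combine g a) ℕ.+ toℕ b                      ≡⟨ cong (λ i → k ℕ.* i ℕ.+ toℕ b) (toℕ-combine g a) ⟩
  k ℕ.* (n ℕ.* toℕ g ℕ.+ toℕ a) ℕ.+ toℕ b                ≡⟨ reassociate n k (toℕ g) (toℕ a) (toℕ b) ⟩
  n ℕ.* k ℕ.* toℕ g ℕ.+ (k ℕ.* toℕ a ℕ.+ toℕ b)          ≡⟨ cong (n ℕ.* k ℕ.* toℕ g ℕ.+_) (toℕ-combine a b) ⟨
  n ℕ.* k ℕ.* toℕ g ℕ.+ toℕ (combine a b)                ≡⟨ sym (toℕ-combine g (combine a b)) ⟩
  toℕ (combine g (combine a b))                           ∎)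
  where
  open ≡-Reasoning
  reassociate : ∀ n k g a b → k ℕ.* (n ℕ.* g ℕ.+ a) ℕ.+ b ≡ n ℕ.* k ℕ.* g ℕ.+ (k ℕ.* a ℕ.+ b)
  reassociate = ℕSolver.solve-∀

remQuot-cast-*-assoc : (x : Fin (m ℕ.* n ℕ.* k)) →
  remQuot {m} (n ℕ.* k) (cast (ℕP.*-assoc m n k) x) ≡
  (quotient n (quotient k x) , combine (remainder {m} n (quotient k x)) (remainder {m ℕ.* n} k x))
remQuot-cast-*-assoc {m} {n} {k} x = begin
  remQuot (n ℕ.* k) (cast (ℕP.*-assoc m n k) x)
    ≡⟨ cong (remQuot (n ℕ.* k) ∘ cast (ℕP.*-assoc m n k)) (sym x≡gab) ⟩
  remQuot (n ℕ.* k) (cast (ℕP.*-assoc m n k) (combine (combine g a) b))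
    ≡⟨ cong (remQuot (n ℕ.* k)) (cast-*-assoc-combine g a b) ⟩
  remQuot (n ℕ.* k) (combine g (combine a b))
    ≡⟨ remQuot-combine g (combine a b) ⟩
  (g , combine a b) ∎
  where
  open ≡-Reasoning
  g = quotient n (quotient k x)
  a = remainder {m} n (quotient k x)
  b = remainder {m ℕ.* n} k x
  x≡gab : combine (combine g a) b ≡ x
  x≡gab = trans (cong (λ p → combine p b) (combine-remQuot {m} n (quotient k x))) (combine-remQuot {m ℕ.* n} k x)

IsSign : ℤ → Set
IsSign a = a ≡ 1ℤ ⊎ a ≡ -1ℤ

sign-square : ∀ {a} → IsSign a → a * a ≡ 1ℤ
sign-square (inj₁ refl) = refl
sign-square (inj₂ refl) = refl

sign-* : ∀ {a b} → IsSign a → IsSign b → IsSign (a * b)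
sign-* (inj₁ refl) (inj₁ refl) = inj₁ refl
sign-* (inj₁ refl) (inj₂ refl) = inj₂ refl
sign-* (inj₂ refl) (inj₁ refl) = inj₂ refl
sign-* (inj₂ refl) (inj₂ refl) = inj₁ refl

sign-cancel : ∀ a {c k k'} → IsSign k → IsSign c → a * k ≡ c * k' → a * c ≡ k * k'
sign-cancel a {c} {k} {k'} k± c± ak≡ck' = begin
  a * c                 ≡⟨ sym (trans (cong ((a * c) *_) (sign-square k±)) (ℤP.*-identityʳ (a * c))) ⟩
  (a * c) * (k * k)     ≡⟨ interchange a c k k ⟩
  (a * k) * (c * k)     ≡⟨ cong (_* (c * k)) ak≡ck' ⟩
  (c * k') * (c * k)    ≡⟨ trans (interchange c k' c k) (cong (_* (k' * k)) (sign-square c±)) ⟩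
  1ℤ * (k' * k)         ≡⟨ trans (ℤP.*-identityˡ (k' * k)) (ℤP.*-comm k' k) ⟩
  k * k'                ∎
  where open ≡-Reasoning

decide₂ : (f g : Fin m → Fin n → ℤ) → True (all? λ i → all? λ j → f i j ℤ.≟ g i j) →
          ∀ i j → f i j ≡ g i j
decide₂ f g = toWitness

K₂ : Mat 2
K₂ = Iₘ 2 -ₘ (Jₘ 2 -ₘ Iₘ 2)

K₂-symmetric : IsSymmetricMat K₂
K₂-symmetric b c = cong (λ d → d - (1ℤ - d)) (δ-sym b c)

K₂-sign : ∀ b c → IsSign (K₂ b c)
K₂-sign 0F 0F = inj₁ refl
K₂-sign 0F 1F = inj₂ refl
K₂-sign 1F 0F = inj₂ refl
K₂-sign 1F 1F = inj₁ refl

K₂-≢ : ∀ {b c} → b ≢ c → K₂ b c ≡ -1ℤ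
K₂-≢ {0F} {0F} b≢c = contradiction refl b≢c
K₂-≢ {0F} {1F} b≢c = refl
K₂-≢ {1F} {0F} b≢c = refl
K₂-≢ {1F} {1F} b≢c = contradiction refl b≢c

K₂-surjective : ∀ {s} → IsSign s → ∀ b → ∃ λ c → K₂ b c ≡ s
K₂-surjective (inj₁ refl) b = b , cong (λ d → d - (1ℤ - d)) (δ-refl b)
K₂-surjective (inj₂ refl) 0F = 1F , refl
K₂-surjective (inj₂ refl) 1F = 0F , refl

K₂-mul : ∀ e b c → K₂ b e * K₂ c e ≡ K₂ b c
K₂-mul 0F = decide₂ _ _ _
K₂-mul 1F = decide₂ _ _ _

Jₘ-*ₘ-K₂ : Jₘ 2 *ₘ K₂ ≡ₘ 0ℤ · K₂
Jₘ-*ₘ-K₂ = pointwise (decide₂ _ _ _)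

K₂-*ₘ-Jₘ : K₂ *ₘ Jₘ 2 ≡ₘ 0ℤ · Jₘ 2
K₂-*ₘ-Jₘ = pointwise (decide₂ _ _ _)

K₂-*ₘ-K₂ : K₂ *ₘ K₂ ≡ₘ + 2 · K₂
K₂-*ₘ-K₂ = pointwise (decide₂ _ _ _)

IsTernaryValue : ℤ → Set
IsTernaryValue w = (w ≡ 0ℤ) ⊎ ((w ≡ 1ℤ) ⊎ (w ≡ -1ℤ))

block-double : ∀ {w} → IsTernaryValue w → ∀ b c → + 2 * block w b c ≡ w * w + w * K₂ b c
block-double (inj₁ refl)        = decide₂ _ _ _
block-double (inj₂ (inj₁ refl)) = decide₂ _ _ _
block-double (inj₂ (inj₂ refl)) = decide₂ _ _ _

indicator : Bool → ℤ
indicator true  = 1ℤ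
indicator false = 0ℤ

indicator-∧ : ∀ a b → indicator (a ∧ b) ≡ indicator a * indicator b
indicator-∧ true  true  = refl
indicator-∧ true  false = refl
indicator-∧ false b     = refl

indicator-sOf : ∀ {m} → m ≡ 0ℤ ⊎ m ≡ 1ℤ → indicator (does (m ℤ.≟ 1ℤ)) ≡ m
indicator-sOf (inj₁ refl) = refl
indicator-sOf (inj₂ refl) = refl

count-tabulate : (p : Fin k → Bool) (f : Fin n → Fin k) →
  + length (filter (λ z → p z Data.Bool.≟ true) (tabulate f)) ≡ ∑[ i < n ] indicator (p (f i))
count-tabulate {n = zero}  p f = refl
count-tabulate {n = suc n} p f with p (f zero) | count-tabulate p (f ∘ suc)
... | true  | ih = cong (_+_ 1ℤ) ih
... | false | ih = trans ih (sym (ℤP.+-identityˡ _))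

countV-∑ : (p : Fin n → Bool) → + countV n p ≡ ∑[ z < n ] indicator (p z)
countV-∑ p = count-tabulate p (λ z → z)

any-allFin : (p : Fin n → Bool) (z : Fin n) → p z ≡ true → any p (allFin n) ≡ true
any-allFin p z pz = Equivalence.to T-≡ (any⁺ p (lose (∈-allFin z) (Equivalence.from T-≡ pz)))

does-true : (d : Dec A) → does d ≡ true → A
does-true (yes a) _ = a
does-true (no _) ()

true⇔true⇒≡ : {a b : Bool} → (a ≡ true ⇔ b ≡ true) → a ≡ b
true⇔true⇒≡ {true}  {true}  _ = refl
true⇔true⇒≡ {true}  {false} a⇔b = sym (Equivalence.to a⇔b refl)
true⇔true⇒≡ {false} {true}  a⇔b = Equivalence.from a⇔b refl
true⇔true⇒≡ {false} {false} _ = refl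

∨-true : ∀ {a b} → a ∨ b ≡ true → a ≡ true ⊎ b ≡ true
∨-true {true}  _  = inj₁ refl
∨-true {false} eq = inj₂ eq

∨-trueˡ : ∀ {a} b → a ≡ true → a ∨ b ≡ true
∨-trueˡ b refl = refl

∨-trueʳ : ∀ a {b} → b ≡ true → a ∨ b ≡ true
∨-trueʳ a refl = ∨-zeroʳ a

sOf-Iₘ : (x y : Fin n) → sOf (Iₘ n) x y ≡ diag x y
sOf-Iₘ x y with x ≟F y
... | yes _ = refl
... | no _  = refl

weight-value : ∀ n → 1 ≤ n → + (4 ℕ.* (n ∸ 1)) ≡ + n * + 4 - + 4
weight-value (suc n) _ = trans (ℤP.pos-* 4 n) (rearrange (+ n))
  where rearrange : ∀ m → + 4 * m ≡ (1ℤ + m) * + 4 - + 4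
        rearrange = solve-∀

weight-nonZero : ∀ n → 2 ≤ n → ℤ.NonZero (+ (4 ℕ.* (n ∸ 1)))
weight-nonZero (suc (suc n)) _ = _
weight-nonZero (suc zero) (s≤s ())

two-elements : 2 ≤ n → ∃₂ λ (i j : Fin n) → i ≢ j
two-elements (s≤s (s≤s _)) = zero , suc zero , λ ()

module Construction {t : ℕ} (W : Mat (t ℕ.* 4)) where

  N : ℕ
  N = t ℕ.* 4 ℕ.* 2

  row : Fin N → Fin (t ℕ.* 4)
  row = quotient 2

  bit : Fin N → Fin 2
  bit = remainder {t ℕ.* 4} 2

  rowGroup : Fin (t ℕ.* 4) → Fin t
  rowGroup = quotient 4

  group : Fin N → Fin t
  group = rowGroup ∘ row

  slot : Fin N → Fin 4
  slot = remainder {t} 4 ∘ row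

  row-combine : ∀ (r : Fin (t ℕ.* 4)) (b : Fin 2) → row (combine r b) ≡ r
  row-combine r b = cong proj₁ (remQuot-combine r b)

  bit-combine : ∀ (r : Fin (t ℕ.* 4)) (b : Fin 2) → bit (combine r b) ≡ b
  bit-combine r b = cong proj₂ (remQuot-combine r b)

  rowGroup-combine : ∀ (g : Fin t) (a : Fin 4) → rowGroup (combine g a) ≡ g
  rowGroup-combine g a = cong proj₁ (remQuot-combine g a)

  ∑-rowGroup : (f : Fin t → ℤ) → ∑[ l < t ℕ.* 4 ] f (rowGroup l) ≡ ∑[ g < t ] (+ 4 * f g)
  ∑-rowGroup f = trans (∑-remQuot t 4 (λ g _ → f g)) (sum-cong-≗ λ g → ∑-const 4 (f g))

  Γ : Mat (t ℕ.* 4)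
  Γ = Iₘ t ⊗ Jₘ 4

  rowFactor : Fin 5 → Mat (t ℕ.* 4)
  rowFactor = Iₘ _ ∷ Iₘ _ ∷ Γ ∷ Jₘ _ ∷ W ∷ []

  bitFactor : Fin 5 → Mat 2
  bitFactor = Iₘ 2 ∷ Jₘ 2 ∷ Jₘ 2 ∷ Jₘ 2 ∷ K₂ ∷ []

  B : Fin 5 → Mat N
  B u = rowFactor u ⊗ bitFactor u

  Q : Mat N
  Q = Iₘ (t ℕ.* 4) ⊗ K₂

  M₀≡B₀ : ∀ x y → M t W 0F x y ≡ B 0F x y
  M₀≡B₀ = Iₘ-⊗ {t ℕ.* 4}

  M₁≡B₁-B₀ : ∀ x y → M t W 1F x y ≡ B 1F x y - B 0F x y
  M₁≡B₁-B₀ x y = distrib (δ (row x) (row y)) (δ (bit x) (bit y))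
    where distrib : ∀ d e → d * (1ℤ - e) ≡ d * 1ℤ - d * e
          distrib = solve-∀

  M₂-value : ∀ x y → M t W 2F x y ≡ δ (group x) (group y) * ((1ℤ - δ (slot x) (slot y)) * 1ℤ)
  M₂-value x y =
    trans (cong₂ (λ p q → δ (proj₁ p) (proj₁ q) * ((Jₘ 4 -ₘ Iₘ 4) ⊗ Jₘ 2) (proj₂ p) (proj₂ q))
                 (remQuot-cast-*-assoc {t} x) (remQuot-cast-*-assoc {t} y))
          (cong₂ (λ p q → δ (group x) (group y) * ((1ℤ - δ (proj₁ p) (proj₁ q)) * 1ℤ))
                 (remQuot-combine (slot x) (bit x)) (remQuot-combine (slot y) (bit y)))

  M₂≡B₂-B₁ : ∀ x y → M t W 2F x y ≡ B 2F x y - B 1F x y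
  M₂≡B₂-B₁ x y = begin
    M t W 2F x y                                       ≡⟨ M₂-value x y ⟩
    δ (group x) (group y) * ((1ℤ - δ (slot x) (slot y)) * 1ℤ)
      ≡⟨ distrib (δ (group x) (group y)) (δ (slot x) (slot y)) ⟩
    B 2F x y - (δ (group x) (group y) * δ (slot x) (slot y)) * 1ℤ
      ≡⟨ cong (λ d → B 2F x y - d * 1ℤ) (sym (Iₘ-⊗ {t} {4} (row x) (row y))) ⟩
    B 2F x y - B 1F x y                                ∎
    where
    open ≡-Reasoning
    distrib : ∀ g s → g * ((1ℤ - s) * 1ℤ) ≡ (g * 1ℤ) * 1ℤ - (g * s) * 1ℤ
    distrib = solve-∀

  α : Fin 5 → Fin 5 → ℤ
  α = (+ 2     ∷ 0ℤ      ∷ 0ℤ  ∷ 0ℤ ∷ 0ℤ  ∷ [])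
    ∷ (- (+ 2) ∷ + 2     ∷ 0ℤ  ∷ 0ℤ ∷ 0ℤ  ∷ [])
    ∷ (0ℤ      ∷ - (+ 2) ∷ + 2 ∷ 0ℤ ∷ 0ℤ  ∷ [])
    ∷ (0ℤ      ∷ 0ℤ      ∷ -1ℤ ∷ 1ℤ ∷ 1ℤ  ∷ [])
    ∷ (0ℤ      ∷ 0ℤ      ∷ -1ℤ ∷ 1ℤ ∷ -1ℤ ∷ [])
    ∷ []

  β : Fin 5 → Fin 5 → ℤ
  β = (1ℤ ∷ 1ℤ ∷ 1ℤ ∷ 1ℤ ∷ 0ℤ  ∷ [])
    ∷ (0ℤ ∷ 1ℤ ∷ 1ℤ ∷ 1ℤ ∷ 0ℤ  ∷ [])
    ∷ (0ℤ ∷ 0ℤ ∷ 1ℤ ∷ 1ℤ ∷ 0ℤ  ∷ [])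
    ∷ (0ℤ ∷ 0ℤ ∷ 0ℤ ∷ 1ℤ ∷ 1ℤ  ∷ [])
    ∷ (0ℤ ∷ 0ℤ ∷ 0ℤ ∷ 1ℤ ∷ -1ℤ ∷ [])
    ∷ []

  α-β : ∀ i k → ∑[ u < 5 ] (α i u * β k u) ≡ + 2 * δ i k
  α-β = decide₂ _ _ _

  record Profile (x y : Fin N) (k : Fin 5) : Set where
    constructor mkProfile
    field B≡β : ∀ u → B u x y ≡ β k u
  open Profile public

  profile : ∀ {x y k} → B 0F x y ≡ β k 0F → B 1F x y ≡ β k 1F → B 2F x y ≡ β k 2F →
            B 3F x y ≡ β k 3F → B 4F x y ≡ β k 4F → Profile x y k
  profile e₀ e₁ e₂ e₃ e₄ = mkProfile λ { 0F → e₀ ; 1F → e₁ ; 2F → e₂ ; 3F → e₃ ; 4F → e₄ }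

  B₁≡δ : ∀ x y → B 1F x y ≡ δ (row x) (row y)
  B₁≡δ x y = ℤP.*-identityʳ _

  B₂≡δ : ∀ x y → B 2F x y ≡ δ (group x) (group y)
  B₂≡δ x y = trans (ℤP.*-identityʳ _) (ℤP.*-identityʳ _)

  Q≡2B₀-B₁ : ∀ x y → Q x y ≡ + 2 * B 0F x y - B 1F x y
  Q≡2B₀-B₁ x y = rearrange (δ (row x) (row y)) (δ (bit x) (bit y))
    where rearrange : ∀ r b → r * (b - (1ℤ - b)) ≡ + 2 * (r * b) - r * 1ℤ
          rearrange = solve-∀

  Γ-*ₘ-Γ : Γ *ₘ Γ ≡ₘ + 4 · Γ
  Γ-*ₘ-Γ = ⊗-*ₘ-≡ₘ (*ₘ-identityˡ (Iₘ t)) (Jₘ-*ₘ-Jₘ 4)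

  Γ-*ₘ-Jₘ : Γ *ₘ Jₘ (t ℕ.* 4) ≡ₘ + 4 · Jₘ (t ℕ.* 4)
  Γ-*ₘ-Jₘ = ⊗-*ₘ-≡ₘ (*ₘ-identityˡ (Jₘ t)) (Jₘ-*ₘ-Jₘ 4)

  Jₘ-*ₘ-Γ : Jₘ (t ℕ.* 4) *ₘ Γ ≡ₘ + 4 · Jₘ (t ℕ.* 4)
  Jₘ-*ₘ-Γ = ⊗-*ₘ-≡ₘ (*ₘ-identityʳ (Jₘ t)) (Jₘ-*ₘ-Jₘ 4)

module Scheme {t : ℕ} {W : Mat (t ℕ.* 4)} (t≥2 : 2 ≤ t)
  (W-weighing : IsWeighing (t ℕ.* 4) (4 ℕ.* (t ∸ 1)) W) (W-sym : IsSymmetricMat W) (W-dbz : DiagBlocksZero t W)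
  where

  open Construction {t} W public

  weight : ℤ
  weight = + (4 ℕ.* (t ∸ 1))

  W-ternary : IsTernary W
  W-ternary = proj₁ W-weighing

  W-orthogonal : ∀ p q → ∑[ l < t ℕ.* 4 ] (W p l * W q l) ≡ weight * δ p q
  W-orthogonal p q = trans (sym (ΣFin≡∑ (t ℕ.* 4) (λ l → W p l * W q l))) (proj₂ W-weighing p q)

  W-*ₘ-W : W *ₘ W ≡ₘ weight · Iₘ (t ℕ.* 4)
  W-*ₘ-W = pointwise λ p q → trans (sum-cong-≗ λ l → cong (W p l *_) (W-sym l q)) (W-orthogonal p q)

  count-outside-group : ∀ g → ∑[ l < t ℕ.* 4 ] (1ℤ - δ g (rowGroup l)) ≡ weight
  count-outside-group g = begin
    ∑[ l < t ℕ.* 4 ] (1ℤ - δ g (rowGroup l))      ≡⟨ ∑-rowGroup (λ h → 1ℤ - δ g h) ⟩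
    ∑[ h < t ] (+ 4 * (1ℤ - δ g h))                ≡⟨ sum-cong-≗ (λ h → distrib (δ g h)) ⟩
    ∑[ h < t ] (+ 4 - δ g h * + 4)                 ≡⟨ ∑-distrib-sub (λ _ → + 4) (λ h → δ g h * + 4) ⟩
    ∑[ h < t ] (+ 4) - ∑[ h < t ] (δ g h * + 4)    ≡⟨ cong₂ _-_ (∑-const t (+ 4)) (∑-δ g (λ _ → + 4)) ⟩
    + t * + 4 - + 4                                ≡⟨ sym (weight-value t (ℕP.<⇒≤ t≥2)) ⟩
    weight                                         ∎
    where
    open ≡-Reasoning
    distrib : ∀ d → + 4 * (1ℤ - d) ≡ + 4 - d * + 4
    distrib = solve-∀

  W-square-slack : ∀ p l → 0ℤ ℤ.≤ (1ℤ - δ (rowGroup p) (rowGroup l)) - W p l * W p l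
  W-square-slack p l with rowGroup p ≟F rowGroup l
  ... | yes same rewrite W-dbz p l same = ℤP.≤-refl
  ... | no _ = square-≤1 (W-ternary p l)
    where
    square-≤1 : ∀ {w} → IsTernaryValue w → 0ℤ ℤ.≤ 1ℤ - w * w
    square-≤1 (inj₁ refl)        = ℤ.+≤+ z≤n
    square-≤1 (inj₂ (inj₁ refl)) = ℤ.+≤+ z≤n
    square-≤1 (inj₂ (inj₂ refl)) = ℤ.+≤+ z≤n

  W-square : ∀ p q → W p q * W p q ≡ 1ℤ - δ (rowGroup p) (rowGroup q)
  W-square p q = sym (ℤP.i-j≡0⇒i≡j _ _ (∑-nonneg-zero _ (W-square-slack p) total-slack q))
    where
    total-slack : ∑[ l < t ℕ.* 4 ] ((1ℤ - δ (rowGroup p) (rowGroup l)) - W p l * W p l) ≡ 0ℤ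
    total-slack = begin
      ∑[ l < t ℕ.* 4 ] ((1ℤ - δ (rowGroup p) (rowGroup l)) - W p l * W p l)
        ≡⟨ ∑-distrib-sub (λ l → 1ℤ - δ (rowGroup p) (rowGroup l)) (λ l → W p l * W p l) ⟩
      ∑[ l < t ℕ.* 4 ] (1ℤ - δ (rowGroup p) (rowGroup l)) - ∑[ l < t ℕ.* 4 ] (W p l * W p l)
        ≡⟨ cong₂ _-_ (count-outside-group (rowGroup p)) (W-orthogonal p p) ⟩
      weight - weight * δ p p              ≡⟨ cong (λ d → weight - weight * d) (δ-refl p) ⟩
      weight - weight * 1ℤ                 ≡⟨ cancel weight ⟩
      0ℤ                                   ∎
      where
      open ≡-Reasoning
      cancel : ∀ a → a - a * 1ℤ ≡ 0ℤ
      cancel = solve-∀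

  W-sign : ∀ p q → rowGroup p ≢ rowGroup q → IsSign (W p q)
  W-sign p q differ with W-ternary p q
  ... | inj₂ ±1 = ±1
  ... | inj₁ W≡0 = contradiction (trans (cong (λ w → w * w) (sym W≡0))
                                        (trans (W-square p q) (cong (_-_ 1ℤ) (δ-≢ differ)))) λ ()

  2M₃≡B₃-B₂+B₄ : ∀ x y → + 2 * M t W 3F x y ≡ B 3F x y - B 2F x y + B 4F x y
  2M₃≡B₃-B₂+B₄ x y = begin
    + 2 * block w (bit x) (bit y)       ≡⟨ block-double (W-ternary (row x) (row y)) (bit x) (bit y) ⟩
    w * w + w * K₂ (bit x) (bit y)      ≡⟨ cong (_+ B 4F x y) (W-square (row x) (row y)) ⟩
    1ℤ - δ (group x) (group y) + B 4F x y ≡⟨ cong (λ d → 1ℤ - d + B 4F x y) (sym (B₂≡δ x y)) ⟩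
    B 3F x y - B 2F x y + B 4F x y      ∎
    where
    open ≡-Reasoning
    w = W (row x) (row y)

  2M₄≡B₃-B₂-B₄ : ∀ x y → + 2 * M t W 4F x y ≡ B 3F x y - B 2F x y - B 4F x y
  2M₄≡B₃-B₂-B₄ x y = begin
    + 2 * ((((1ℤ - m₀) - m₁) - m₂) - m₃)      ≡⟨ distribute m₀ m₁ m₂ m₃ ⟩
    + 2 - + 2 * (m₀ + m₁ + m₂) - + 2 * m₃
      ≡⟨ cong₂ (λ a b → + 2 - + 2 * a - b) telescope (2M₃≡B₃-B₂+B₄ x y) ⟩
    + 2 - + 2 * b₂ - (1ℤ - b₂ + b₄)           ≡⟨ simplify b₂ b₄ ⟩
    1ℤ - b₂ - b₄                              ∎
    where
    open ≡-Reasoning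
    m₀ = M t W 0F x y
    m₁ = M t W 1F x y
    m₂ = M t W 2F x y
    m₃ = M t W 3F x y
    b₂ = B 2F x y
    b₄ = B 4F x y
    telescope : m₀ + m₁ + m₂ ≡ b₂
    telescope = begin
      m₀ + m₁ + m₂
        ≡⟨ cong₂ (λ a b → a + b + m₂) (M₀≡B₀ x y) (M₁≡B₁-B₀ x y) ⟩
      B 0F x y + (B 1F x y - B 0F x y) + m₂
        ≡⟨ cong (_+_ (B 0F x y + (B 1F x y - B 0F x y))) (M₂≡B₂-B₁ x y) ⟩
      B 0F x y + (B 1F x y - B 0F x y) + (b₂ - B 1F x y)
        ≡⟨ collapse (B 0F x y) (B 1F x y) b₂ ⟩
      b₂ ∎
      where collapse : ∀ a b c → a + (b - a) + (c - b) ≡ c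
            collapse = solve-∀
    distribute : ∀ a b c d → + 2 * ((((1ℤ - a) - b) - c) - d) ≡ + 2 - + 2 * (a + b + c) - + 2 * d
    distribute = solve-∀
    simplify : ∀ b c → + 2 - + 2 * b - (1ℤ - b + c) ≡ 1ℤ - b - c
    simplify = solve-∀

  -- The right-hand sides of the rearrangements below are ∑[ u < 5 ] (α i u * B u x y) unfolded.
  M-span : ∀ i x y → + 2 * M t W i x y ≡ ∑[ u < 5 ] (α i u * B u x y)
  M-span 0F x y = trans (cong (_*_ (+ 2)) (M₀≡B₀ x y)) (sym (ℤP.+-identityʳ _))
  M-span 1F x y = trans (cong (_*_ (+ 2)) (M₁≡B₁-B₀ x y)) (rearrange (B 0F x y) (B 1F x y))
    where rearrange : ∀ b₀ b₁ → + 2 * (b₁ - b₀) ≡ - (+ 2) * b₀ + (+ 2 * b₁ + 0ℤ)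
          rearrange = solve-∀
  M-span 2F x y = trans (cong (_*_ (+ 2)) (M₂≡B₂-B₁ x y)) (rearrange (B 0F x y) (B 1F x y) (B 2F x y))
    where rearrange : ∀ b₀ b₁ b₂ → + 2 * (b₂ - b₁) ≡ 0ℤ * b₀ + (- (+ 2) * b₁ + (+ 2 * b₂ + 0ℤ))
          rearrange = solve-∀
  M-span 3F x y = trans (2M₃≡B₃-B₂+B₄ x y) (rearrange (B 0F x y) (B 1F x y) (B 2F x y) (B 4F x y))
    where rearrange : ∀ b₀ b₁ b₂ b₄ →
                      1ℤ - b₂ + b₄ ≡ 0ℤ * b₀ + (0ℤ * b₁ + (-1ℤ * b₂ + (1ℤ + (1ℤ * b₄ + 0ℤ))))
          rearrange = solve-∀
  M-span 4F x y = trans (2M₄≡B₃-B₂-B₄ x y) (rearrange (B 0F x y) (B 1F x y) (B 2F x y) (B 4F x y))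
    where rearrange : ∀ b₀ b₁ b₂ b₄ →
                      1ℤ - b₂ - b₄ ≡ 0ℤ * b₀ + (0ℤ * b₁ + (-1ℤ * b₂ + (1ℤ + (-1ℤ * b₄ + 0ℤ))))
          rearrange = solve-∀

  -- The classes

  R : Fin 5 → Rel N
  R i = sOf (M t W i)

  M-on-profile : ∀ {x y k} → Profile x y k → ∀ i → M t W i x y ≡ δ i k
  M-on-profile {x} {y} {k} P i = ℤP.*-cancelˡ-≡ (+ 2) _ _ (begin
    + 2 * M t W i x y               ≡⟨ M-span i x y ⟩
    ∑[ u < 5 ] (α i u * B u x y)    ≡⟨ sum-cong-≗ (λ u → cong (α i u *_) (B≡β P u)) ⟩
    ∑[ u < 5 ] (α i u * β k u)      ≡⟨ α-β i k ⟩
    + 2 * δ i k                     ∎)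
    where open ≡-Reasoning

  B₄-sign : ∀ x y → group x ≢ group y → IsSign (B 4F x y)
  B₄-sign x y differ = sign-* (W-sign (row x) (row y) differ) (K₂-sign (bit x) (bit y))

  profile-same-point : ∀ {x y} → row x ≡ row y → bit x ≡ bit y → Profile x y 0F
  profile-same-point r≡ b≡ = profile
    (cong₂ _*_ (δ-≡ r≡) (δ-≡ b≡))
    (cong (_* 1ℤ) (δ-≡ r≡))
    (cong (λ d → (d * 1ℤ) * 1ℤ) (δ-≡ (cong rowGroup r≡)))
    refl
    (cong (_* _) (W-dbz _ _ (cong rowGroup r≡)))

  profile-pair : ∀ {x y} → row x ≡ row y → bit x ≢ bit y → Profile x y 1F
  profile-pair r≡ b≢ = profile
    (cong₂ _*_ (δ-≡ r≡) (δ-≢ b≢))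
    (cong (_* 1ℤ) (δ-≡ r≡))
    (cong (λ d → (d * 1ℤ) * 1ℤ) (δ-≡ (cong rowGroup r≡)))
    refl
    (cong (_* _) (W-dbz _ _ (cong rowGroup r≡)))

  profile-group : ∀ {x y} → group x ≡ group y → row x ≢ row y → Profile x y 2F
  profile-group {x} {y} g≡ r≢ = profile
    (cong (_* δ (bit x) (bit y)) (δ-≢ r≢))
    (cong (_* 1ℤ) (δ-≢ r≢))
    (cong (λ d → (d * 1ℤ) * 1ℤ) (δ-≡ g≡))
    refl
    (cong (_* _) (W-dbz _ _ g≡))

  B₀B₁B₂≡0 : ∀ {x y} → group x ≢ group y → B 0F x y ≡ 0ℤ × B 1F x y ≡ 0ℤ × B 2F x y ≡ 0ℤ
  B₀B₁B₂≡0 {x} {y} g≢ =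
    cong (_* δ (bit x) (bit y)) (δ-≢ (g≢ ∘ cong rowGroup)) ,
    cong (_* 1ℤ) (δ-≢ (g≢ ∘ cong rowGroup)) ,
    cong (λ d → (d * 1ℤ) * 1ℤ) (δ-≢ g≢)

  profile-outer : ∀ {x y} k → β k 2F ≡ 0ℤ → group x ≢ group y → B 4F x y ≡ β k 4F → Profile x y k
  profile-outer 3F _ g≢ B₄≡ = let (e₀ , e₁ , e₂) = B₀B₁B₂≡0 g≢ in profile e₀ e₁ e₂ refl B₄≡
  profile-outer 4F _ g≢ B₄≡ = let (e₀ , e₁ , e₂) = B₀B₁B₂≡0 g≢ in profile e₀ e₁ e₂ refl B₄≡

  classify : ∀ x y → ∃ (Profile x y)
  classify x y with row x ≟F row y | bit x ≟F bit y | group x ≟F group y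
  ... | yes r≡ | yes b≡ | _      = 0F , profile-same-point r≡ b≡
  ... | yes r≡ | no b≢  | _      = 1F , profile-pair r≡ b≢
  ... | no r≢  | _      | yes g≡ = 2F , profile-group g≡ r≢
  ... | no r≢  | _      | no g≢  with B₄-sign x y g≢
  ...   | inj₁ B₄≡1  = 3F , profile-outer 3F refl g≢ B₄≡1
  ...   | inj₂ B₄≡-1 = 4F , profile-outer 4F refl g≢ B₄≡-1

  profile⇒R : ∀ {x y k} → Profile x y k → R k x y ≡ true
  profile⇒R {x} {y} {k} P = dec-true (M t W k x y ℤ.≟ 1ℤ) (trans (M-on-profile P k) (δ-refl k))

  R-unique : ∀ {x y} i {j} → R i x y ≡ true → Profile x y j → i ≡ j
  R-unique {x} {y} i Ri P = δ≡1⇒≡ (trans (sym (M-on-profile P i)) (does-true (M t W i x y ℤ.≟ 1ℤ) Ri))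

  R⇒profile : ∀ {x y} k → R k x y ≡ true → Profile x y k
  R⇒profile {x} {y} k Rk = let (k' , P) = classify x y in subst (Profile x y) (sym (R-unique k Rk P)) P

  rowFactor-symmetric : ∀ u → IsSymmetricMat (rowFactor u)
  rowFactor-symmetric 0F = Iₘ-symmetric
  rowFactor-symmetric 1F = Iₘ-symmetric
  rowFactor-symmetric 2F = ⊗-symmetric {A = Iₘ t} {G = Jₘ 4} Iₘ-symmetric Jₘ-symmetric
  rowFactor-symmetric 3F = Jₘ-symmetric
  rowFactor-symmetric 4F = W-sym

  bitFactor-symmetric : ∀ u → IsSymmetricMat (bitFactor u)
  bitFactor-symmetric 0F = Iₘ-symmetric
  bitFactor-symmetric 1F = Jₘ-symmetric
  bitFactor-symmetric 2F = Jₘ-symmetric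
  bitFactor-symmetric 3F = Jₘ-symmetric
  bitFactor-symmetric 4F = K₂-symmetric

  profile-transpose : ∀ {x y k} → Profile x y k → Profile y x k
  profile-transpose {x} {y} P = mkProfile λ u →
    trans (⊗-symmetric {A = rowFactor u} {G = bitFactor u} (rowFactor-symmetric u) (bitFactor-symmetric u) y x)
          (B≡β P u)

  R-symmetric : ∀ i x y → R i x y ≡ R i y x
  R-symmetric i x y = true⇔true⇒≡ (mk⇔ transpose transpose)
    where transpose : ∀ {x y} → R i x y ≡ true → R i y x ≡ true
          transpose Rxy = profile⇒R (profile-transpose (R⇒profile i Rxy))

  B₄-combine : ∀ v l e → B 4F v (combine l e) ≡ W (row v) l * K₂ (bit v) e
  B₄-combine v l e = cong₂ (λ r b → W (row v) r * K₂ (bit v) b) (row-combine l e) (bit-combine l e)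

  B₄-attains : ∀ w l {σ} → rowGroup l ≢ group w → IsSign σ → ∃ λ e → B 4F w (combine l e) ≡ σ
  B₄-attains w l {σ} l-outside σ± = e , (begin
    B 4F w (combine l e)        ≡⟨ B₄-combine w l e ⟩
    ω * K₂ (bit w) e            ≡⟨ cong (ω *_) K≡ωσ ⟩
    ω * (ω * σ)                 ≡⟨ sym (ℤP.*-assoc ω ω σ) ⟩
    (ω * ω) * σ                 ≡⟨ cong (_* σ) (sign-square ω±) ⟩
    1ℤ * σ                      ≡⟨ ℤP.*-identityˡ σ ⟩
    σ                           ∎)
    where
    open ≡-Reasoning
    ω = W (row w) l
    ω± = W-sign (row w) l (l-outside ∘ sym)
    e = proj₁ (K₂-surjective (sign-* ω± σ±) (bit w))
    K≡ωσ = proj₂ (K₂-surjective (sign-* ω± σ±) (bit w))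

  outer-sign : ∀ s → β s 2F ≡ 0ℤ → IsSign (β s 4F)
  outer-sign 3F _ = inj₁ refl
  outer-sign 4F _ = inj₂ refl

  R-outer : ∀ {x y} s → β s 2F ≡ 0ℤ → R s x y ≡ true → group x ≢ group y × B 4F x y ≡ β s 4F
  R-outer {x} {y} s outer Rs =
    δ≡0⇒≢ (trans (sym (B₂≡δ x y)) (trans (B≡β P 2F) outer)) , B≡β P 4F
    where P = R⇒profile s Rs

  group-combine : ∀ g a b → group (combine (combine g a) b) ≡ g
  group-combine g a b = trans (cong rowGroup (row-combine (combine g a) b)) (rowGroup-combine g a)

  g₀ g₁ : Fin t
  g₀ = proj₁ (two-elements t≥2)
  g₁ = proj₁ (proj₂ (two-elements t≥2))

  g₀≢g₁ : g₀ ≢ g₁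
  g₀≢g₁ = proj₂ (proj₂ (two-elements t≥2))

  r₀ r₁ : Fin (t ℕ.* 4)
  r₀ = combine g₀ 0F
  r₁ = combine g₀ 1F

  x₀ : Fin N
  x₀ = combine r₀ 0F

  outer-witness : ∀ s → β s 2F ≡ 0ℤ → ∃ λ x → ∃ λ y → R s x y ≡ true
  outer-witness s outer = x₀ , combine r₂ e , profile⇒R (profile-outer s outer x₀-outside B₄≡σ)
    where
    r₂ = combine g₁ 0F
    r₂-outside : rowGroup r₂ ≢ group x₀
    r₂-outside same = g₀≢g₁ (trans (sym (group-combine g₀ 0F 0F)) (trans (sym same) (rowGroup-combine g₁ 0F)))
    e = proj₁ (B₄-attains x₀ r₂ r₂-outside (outer-sign s outer))
    B₄≡σ = proj₂ (B₄-attains x₀ r₂ r₂-outside (outer-sign s outer))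
    x₀-outside : group x₀ ≢ group (combine r₂ e)
    x₀-outside same = r₂-outside (sym (trans same (cong rowGroup (row-combine r₂ e))))

  nonempty : ∀ k → ∃ λ x → ∃ λ y → R k x y ≡ true
  nonempty 0F = x₀ , x₀ , profile⇒R (profile-same-point {x₀} {x₀} refl refl)
  nonempty 1F = combine r₀ 0F , combine r₀ 1F ,
    profile⇒R (profile-pair (trans (row-combine r₀ 0F) (sym (row-combine r₀ 1F)))
                            (λ b≡ → contradiction (trans (sym (bit-combine r₀ 0F)) (trans b≡ (bit-combine r₀ 1F))) λ ()))
  nonempty 2F = combine r₀ 0F , combine r₁ 0F ,
    profile⇒R (profile-group (trans (group-combine g₀ 0F 0F) (sym (group-combine g₀ 1F 0F)))
                             (λ r≡ → contradiction (combine-injectiveʳ g₀ 0F g₀ 1F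
                                        (trans (sym (row-combine r₀ 0F)) (trans r≡ (row-combine r₁ 0F)))) λ ()))
  nonempty 3F = outer-witness 3F refl
  nonempty 4F = outer-witness 4F refl

  -- Intersection numbers

  Invariant : Mat N → Set
  Invariant F = ∀ {k x y x' y'} → Profile x y k → Profile x' y' k → F x y ≡ F x' y'

  B-invariant : ∀ u → Invariant (B u)
  B-invariant u P P' = trans (B≡β P u) (sym (B≡β P' u))

  Q-invariant : Invariant Q
  Q-invariant {x = x} {y} {x'} {y'} P P' = begin
    Q x y                         ≡⟨ Q≡2B₀-B₁ x y ⟩
    + 2 * B 0F x y - B 1F x y     ≡⟨ cong₂ (λ a b → + 2 * a - b) (B-invariant 0F P P') (B-invariant 1F P P') ⟩
    + 2 * B 0F x' y' - B 1F x' y' ≡⟨ sym (Q≡2B₀-B₁ x' y') ⟩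
    Q x' y'                       ∎
    where open ≡-Reasoning

  scaled-invariant : ∀ {F G c H} → F *ₘ G ≡ₘ c · H → Invariant H → Invariant (F *ₘ G)
  scaled-invariant {c = c} FG H-invariant P P' =
    trans (at FG _ _) (trans (cong (c *_) (H-invariant P P')) (sym (at FG _ _)))

  annihilated-invariant : ∀ {F G H} → F *ₘ G ≡ₘ 0ℤ · H → Invariant (F *ₘ G)
  annihilated-invariant FG P P' = trans (at FG _ _) (sym (at FG _ _))

  B*B-invariant : ∀ u v → Invariant (B u *ₘ B v)
  B*B-invariant 0F v  = scaled-invariant (⊗-*ₘ-≡ₘ (*ₘ-identityˡ (rowFactor v)) (*ₘ-identityˡ (bitFactor v)))
                                         (B-invariant v)
  B*B-invariant u  0F = scaled-invariant (⊗-*ₘ-≡ₘ (*ₘ-identityʳ (rowFactor u)) (*ₘ-identityʳ (bitFactor u)))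
                                         (B-invariant u)
  B*B-invariant 1F 1F = scaled-invariant (⊗-*ₘ-≡ₘ (*ₘ-identityˡ (Iₘ (t ℕ.* 4))) (Jₘ-*ₘ-Jₘ 2)) (B-invariant 1F)
  B*B-invariant 1F 2F = scaled-invariant (⊗-*ₘ-≡ₘ (*ₘ-identityˡ Γ) (Jₘ-*ₘ-Jₘ 2)) (B-invariant 2F)
  B*B-invariant 1F 3F = scaled-invariant (⊗-*ₘ-≡ₘ (*ₘ-identityˡ (Jₘ (t ℕ.* 4))) (Jₘ-*ₘ-Jₘ 2)) (B-invariant 3F)
  B*B-invariant 2F 1F = scaled-invariant (⊗-*ₘ-≡ₘ (*ₘ-identityʳ Γ) (Jₘ-*ₘ-Jₘ 2)) (B-invariant 2F)
  B*B-invariant 2F 2F = scaled-invariant (⊗-*ₘ-≡ₘ Γ-*ₘ-Γ (Jₘ-*ₘ-Jₘ 2)) (B-invariant 2F)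
  B*B-invariant 2F 3F = scaled-invariant (⊗-*ₘ-≡ₘ Γ-*ₘ-Jₘ (Jₘ-*ₘ-Jₘ 2)) (B-invariant 3F)
  B*B-invariant 3F 1F = scaled-invariant (⊗-*ₘ-≡ₘ (*ₘ-identityʳ (Jₘ (t ℕ.* 4))) (Jₘ-*ₘ-Jₘ 2)) (B-invariant 3F)
  B*B-invariant 3F 2F = scaled-invariant (⊗-*ₘ-≡ₘ Jₘ-*ₘ-Γ (Jₘ-*ₘ-Jₘ 2)) (B-invariant 3F)
  B*B-invariant 3F 3F = scaled-invariant (⊗-*ₘ-≡ₘ (Jₘ-*ₘ-Jₘ (t ℕ.* 4)) (Jₘ-*ₘ-Jₘ 2)) (B-invariant 3F)
  B*B-invariant 4F 4F = scaled-invariant (⊗-*ₘ-≡ₘ W-*ₘ-W K₂-*ₘ-K₂) Q-invariant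
  B*B-invariant 1F 4F = annihilated-invariant (⊗-*ₘ-≡ₘ (*ₘ-≡ₘ-refl (Iₘ (t ℕ.* 4)) W) Jₘ-*ₘ-K₂)
  B*B-invariant 2F 4F = annihilated-invariant (⊗-*ₘ-≡ₘ (*ₘ-≡ₘ-refl Γ W) Jₘ-*ₘ-K₂)
  B*B-invariant 3F 4F = annihilated-invariant (⊗-*ₘ-≡ₘ (*ₘ-≡ₘ-refl (Jₘ (t ℕ.* 4)) W) Jₘ-*ₘ-K₂)
  B*B-invariant 4F 1F = annihilated-invariant (⊗-*ₘ-≡ₘ (*ₘ-≡ₘ-refl W (Iₘ (t ℕ.* 4))) K₂-*ₘ-Jₘ)
  B*B-invariant 4F 2F = annihilated-invariant (⊗-*ₘ-≡ₘ (*ₘ-≡ₘ-refl W Γ) K₂-*ₘ-Jₘ)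
  B*B-invariant 4F 3F = annihilated-invariant (⊗-*ₘ-≡ₘ (*ₘ-≡ₘ-refl W (Jₘ (t ℕ.* 4))) K₂-*ₘ-Jₘ)

  M*M-expansion : ∀ i j x y →
    + 4 * (M t W i *ₘ M t W j) x y ≡ ∑[ u < 5 ] ∑[ v < 5 ] ((α i u * α j v) * (B u *ₘ B v) x y)
  M*M-expansion i j x y = begin
    + 4 * ∑[ z < N ] (M t W i x z * M t W j z y)
      ≡⟨ *-distribˡ-sum (+ 4) (λ z → M t W i x z * M t W j z y) ⟩
    ∑[ z < N ] (+ 4 * (M t W i x z * M t W j z y))
      ≡⟨ sum-cong-≗ (λ z → trans (interchange (+ 2) (+ 2) (M t W i x z) (M t W j z y))
                                 (cong₂ _*_ (M-span i x z) (M-span j z y))) ⟩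
    ∑[ z < N ] (∑[ u < 5 ] (α i u * B u x z) * ∑[ v < 5 ] (α j v * B v z y))
      ≡⟨ *ₘ-bilinear (α i) (α j) B B x y ⟩
    ∑[ u < 5 ] ∑[ v < 5 ] ((α i u * α j v) * (B u *ₘ B v) x y) ∎
    where open ≡-Reasoning

  M*M-invariant : ∀ i j → Invariant (M t W i *ₘ M t W j)
  M*M-invariant i j {x = x} {y} {x'} {y'} P P' = ℤP.*-cancelˡ-≡ (+ 4) _ _ (begin
    + 4 * (M t W i *ₘ M t W j) x y                                  ≡⟨ M*M-expansion i j x y ⟩
    ∑[ u < 5 ] ∑[ v < 5 ] ((α i u * α j v) * (B u *ₘ B v) x y)
      ≡⟨ sum-cong-≗ (λ u → sum-cong-≗ λ v → cong ((α i u * α j v) *_) (B*B-invariant u v P P')) ⟩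
    ∑[ u < 5 ] ∑[ v < 5 ] ((α i u * α j v) * (B u *ₘ B v) x' y')  ≡⟨ sym (M*M-expansion i j x' y') ⟩
    + 4 * (M t W i *ₘ M t W j) x' y'                                ∎)
    where open ≡-Reasoning

  indicator-R : ∀ i x y → indicator (R i x y) ≡ M t W i x y
  indicator-R i x y = let (k , P) = classify x y in
    indicator-sOf (subst (λ m → m ≡ 0ℤ ⊎ m ≡ 1ℤ) (sym (M-on-profile P i)) (δ-binary i k))

  count≡M*M : ∀ i j x y → + countV N (λ z → R i x z ∧ R j z y) ≡ (M t W i *ₘ M t W j) x y
  count≡M*M i j x y = trans (countV-∑ (λ z → R i x z ∧ R j z y)) (sum-cong-≗ λ z →
    trans (indicator-∧ (R i x z) (R j z y)) (cong₂ _*_ (indicator-R i x z) (indicator-R j z y)))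

  intersection-number : ∀ i j {k x y x' y'} → Profile x y k → Profile x' y' k →
    countV N (λ z → R i x z ∧ R j z y) ≡ countV N (λ z → R i x' z ∧ R j z y')
  intersection-number i j {x = x} {y} {x'} {y'} P P' = ℤP.+-injective (begin
    + countV N (λ z → R i x z ∧ R j z y)     ≡⟨ count≡M*M i j x y ⟩
    (M t W i *ₘ M t W j) x y                 ≡⟨ M*M-invariant i j P P' ⟩
    (M t W i *ₘ M t W j) x' y'               ≡⟨ sym (count≡M*M i j x' y') ⟩
    + countV N (λ z → R i x' z ∧ R j z y')   ∎)
    where open ≡-Reasoning

  association-scheme : IsAssociationScheme R
  association-scheme = record
    { covers       = λ x y → let (k , P) = classify x y in k , profile⇒R P
    ; disjoint     = λ i j x y Ri Rj → R-unique i Ri (R⇒profile j Rj)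
    ; nonempty     = nonempty
    ; hasDiagonal  = 0F , sOf-Iₘ
    ; closedTrans  = λ i → i , R-symmetric i
    ; intersection = λ i j k → let (x₀ , y₀ , R₀) = nonempty k in
        countV N (λ z → R i x₀ z ∧ R j z y₀) ,
        λ x y Rk → intersection-number i j (R⇒profile k Rk) (R⇒profile k R₀)
    }

  -- Parabolics and radicals

  parabolic : ∀ {n} (f : Fin N → Fin n) u → (∀ x y → B u x y ≡ δ (f x) (f y)) →
              (e : Rel N) → (∀ x y → e x y ≡ true ⇔ f x ≡ f y) → IsParabolic R e
  parabolic f u B≡δ e e⇔ = record
    { refl′  = λ x → from (e⇔ x x) refl
    ; sym′   = λ x y exy → from (e⇔ y x) (sym (to (e⇔ x y) exy))
    ; trans′ = λ x y z exy eyz → from (e⇔ x z) (trans (to (e⇔ x y) exy) (to (e⇔ y z) eyz))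
    ; union  = (λ k → does (β k u ℤ.≟ 1ℤ)) , λ x y → mk⇔ (into x y) (out-of x y)
    }
    where
    open Equivalence
    into : ∀ x y → e x y ≡ true → ∃ λ i → does (β i u ℤ.≟ 1ℤ) ≡ true × R i x y ≡ true
    into x y exy = let (k , P) = classify x y in
      k , dec-true (β k u ℤ.≟ 1ℤ) (trans (sym (B≡β P u)) (trans (B≡δ x y) (δ-≡ (to (e⇔ x y) exy)))) , profile⇒R P
    out-of : ∀ x y → (∃ λ i → does (β i u ℤ.≟ 1ℤ) ≡ true × R i x y ≡ true) → e x y ≡ true
    out-of x y (i , βᵢ≡1 , Rᵢ) = from (e⇔ x y)
      (δ≡1⇒≡ (trans (sym (B≡δ x y)) (trans (B≡β (R⇒profile i Rᵢ) u) (does-true (β i u ℤ.≟ 1ℤ) βᵢ≡1))))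

  e₀ : Rel N
  e₀ = diag ∪ R 1F

  e₁ : Rel N
  e₁ = e₀ ∪ R 2F

  same-row : ∀ {x y} k → R k x y ≡ true → β k 1F ≡ 1ℤ → row x ≡ row y
  same-row {x} {y} k Rk β≡1 = δ≡1⇒≡ (trans (sym (B₁≡δ x y)) (trans (B≡β (R⇒profile k Rk) 1F) β≡1))

  same-group : ∀ {x y} k → R k x y ≡ true → β k 2F ≡ 1ℤ → group x ≡ group y
  same-group {x} {y} k Rk β≡1 = δ≡1⇒≡ (trans (sym (B₂≡δ x y)) (trans (B≡β (R⇒profile k Rk) 2F) β≡1))

  e₀⇔same-row : ∀ x y → e₀ x y ≡ true ⇔ row x ≡ row y
  e₀⇔same-row x y = mk⇔ to from
    where
    to : e₀ x y ≡ true → row x ≡ row y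
    to e₀xy with ∨-true e₀xy
    ... | inj₁ diagxy = same-row 0F (trans (sOf-Iₘ x y) diagxy) refl
    ... | inj₂ R₁xy   = same-row 1F R₁xy refl
    from : row x ≡ row y → e₀ x y ≡ true
    from r≡ = by-bit (bit x ≟F bit y)
      where
      by-bit : Dec (bit x ≡ bit y) → e₀ x y ≡ true
      by-bit (yes b≡) = ∨-trueˡ (R 1F x y) (trans (sym (sOf-Iₘ x y)) (profile⇒R (profile-same-point r≡ b≡)))
      by-bit (no b≢)  = ∨-trueʳ (diag x y) (profile⇒R (profile-pair r≡ b≢))

  e₁⇔same-group : ∀ x y → e₁ x y ≡ true ⇔ group x ≡ group y
  e₁⇔same-group x y = mk⇔ to from
    where
    to : e₁ x y ≡ true → group x ≡ group y
    to e₁xy with ∨-true e₁xy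
    ... | inj₁ e₀xy = cong rowGroup (Equivalence.to (e₀⇔same-row x y) e₀xy)
    ... | inj₂ R₂xy = same-group 2F R₂xy refl
    from : group x ≡ group y → e₁ x y ≡ true
    from g≡ = by-row (row x ≟F row y)
      where
      by-row : Dec (row x ≡ row y) → e₁ x y ≡ true
      by-row (yes r≡) = ∨-trueˡ (R 2F x y) (Equivalence.from (e₀⇔same-row x y) r≡)
      by-row (no r≢)  = ∨-trueʳ (e₀ x y) (profile⇒R (profile-group g≡ r≢))

  inner⊆e₁ : ∀ s → β s 2F ≡ 1ℤ → R s ⊆ e₁
  inner⊆e₁ s β≡1 x y Rs = Equivalence.from (e₁⇔same-group x y) (same-group s Rs β≡1)

  rows-agreeing-off-block : ∀ p q c → (∀ l → rowGroup l ≢ rowGroup p → W p l * W q l ≡ c) → δ p q ≡ c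
  rows-agreeing-off-block p q c agree = ℤP.*-cancelˡ-≡ weight _ _ {{weight-nonZero t t≥2}} (begin
    weight * δ p q                                          ≡⟨ sym (W-orthogonal p q) ⟩
    ∑[ l < t ℕ.* 4 ] (W p l * W q l)                        ≡⟨ sum-cong-≗ on-block-or-agree ⟩
    ∑[ l < t ℕ.* 4 ] ((1ℤ - δ (rowGroup p) (rowGroup l)) * c)
      ≡⟨ sym (*-distribʳ-sum c (λ l → 1ℤ - δ (rowGroup p) (rowGroup l))) ⟩
    ∑[ l < t ℕ.* 4 ] (1ℤ - δ (rowGroup p) (rowGroup l)) * c ≡⟨ cong (_* c) (count-outside-group (rowGroup p)) ⟩
    weight * c                                              ∎)
    where
    open ≡-Reasoning
    on-block-or-agree : ∀ l → W p l * W q l ≡ (1ℤ - δ (rowGroup p) (rowGroup l)) * c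
    on-block-or-agree l with rowGroup p ≟F rowGroup l
    ... | yes same rewrite W-dbz p l same = refl
    ... | no differ = trans (agree l (differ ∘ sym)) (sym (ℤP.*-identityˡ c))

  separating-row : ∀ p q c → δ p q ≢ c → ∃ λ l → rowGroup l ≢ rowGroup p × W p l * W q l ≢ c
  separating-row p q c δ≢c with ¬∀⟶∃¬ (t ℕ.* 4) Agrees agrees? (δ≢c ∘ rows-agreeing-off-block p q c)
    where
    Agrees : Fin (t ℕ.* 4) → Set
    Agrees l = rowGroup l ≢ rowGroup p → W p l * W q l ≡ c
    agrees? : ∀ l → Dec (Agrees l)
    agrees? l = ¬? (rowGroup l ≟F rowGroup p) →-dec (W p l * W q l ℤ.≟ c)
  ... | l , ¬agrees = l , (λ same → ¬agrees λ differ → contradiction same differ) , (λ eq → ¬agrees λ _ → eq)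

  δ-row≢K₂-bit : ∀ {x y} → x ≢ y → δ (row x) (row y) ≢ K₂ (bit x) (bit y)
  δ-row≢K₂-bit {x} {y} x≢y with row x ≟F row y
  ... | yes r≡ = λ 1≡K → contradiction (trans 1≡K (K₂-≢ b≢)) λ ()
    where b≢ = λ b≡ → x≢y (remQuot-injective x y (cong₂ _,_ r≡ b≡))
  ... | no _ with K₂-sign (bit x) (bit y)
  ...   | inj₁ K≡1  = λ 0≡K → contradiction (trans 0≡K K≡1) λ ()
  ...   | inj₂ K≡-1 = λ 0≡K → contradiction (trans 0≡K K≡-1) λ ()

  Separated : Fin 5 → Fin N → Fin N → Set
  Separated s x w = ∃ λ y → R s w y ≡ true × R s x y ≢ true

  separated-across-groups : ∀ {x w} s → β s 2F ≡ 0ℤ → group x ≢ group w → Separated s x w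
  separated-across-groups {x} {w} s outer g≢ =
    combine (row x) e ,
    profile⇒R (profile-outer s outer (λ w~y → g≢ (trans (sym y-group) (sym w~y))) B₄≡σ) ,
    λ Rsxy → proj₁ (R-outer s outer Rsxy) (sym y-group)
    where
    e = proj₁ (B₄-attains w (row x) g≢ (outer-sign s outer))
    B₄≡σ = proj₂ (B₄-attains w (row x) g≢ (outer-sign s outer))
    y-group : group (combine (row x) e) ≡ group x
    y-group = cong rowGroup (row-combine (row x) e)

  separated-within-group : ∀ {x w} s → β s 2F ≡ 0ℤ → x ≢ w → group x ≡ group w → Separated s x w
  separated-within-group {x} {w} s outer x≢w g≡ =
    combine l e ,
    profile⇒R (profile-outer s outer (λ w~y → l-outside (sym (trans g≡ (trans w~y y-group)))) B₄≡σ) ,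
    disagree ∘ agree
    where
    separating = separating-row (row x) (row w) (K₂ (bit x) (bit w)) (δ-row≢K₂-bit x≢w)
    l = proj₁ separating
    l-outside = proj₁ (proj₂ separating)
    disagree = proj₂ (proj₂ separating)
    w-outside : rowGroup (row w) ≢ rowGroup l
    w-outside w~l = l-outside (sym (trans g≡ w~l))
    e = proj₁ (B₄-attains w l (w-outside ∘ sym) (outer-sign s outer))
    B₄≡σ = proj₂ (B₄-attains w l (w-outside ∘ sym) (outer-sign s outer))
    y-group : group (combine l e) ≡ rowGroup l
    y-group = cong rowGroup (row-combine l e)
    agree : R s x (combine l e) ≡ true → W (row x) l * W (row w) l ≡ K₂ (bit x) (bit w)
    agree Rsxy = begin
      W (row x) l * W (row w) l
        ≡⟨ sign-cancel (W (row x) l) (K₂-sign (bit x) e) (W-sign (row w) l w-outside) (begin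
             W (row x) l * K₂ (bit x) e  ≡⟨ sym (B₄-combine x l e) ⟩
             B 4F x (combine l e)        ≡⟨ proj₂ (R-outer s outer Rsxy) ⟩
             β s 4F                      ≡⟨ sym B₄≡σ ⟩
             B 4F w (combine l e)        ≡⟨ B₄-combine w l e ⟩
             W (row w) l * K₂ (bit w) e  ∎) ⟩
      K₂ (bit x) e * K₂ (bit w) e
        ≡⟨ K₂-mul e (bit x) (bit w) ⟩
      K₂ (bit x) (bit w) ∎
      where open ≡-Reasoning

  outer-separated : ∀ {x w} s → β s 2F ≡ 0ℤ → x ≢ w → Separated s x w
  outer-separated {x} {w} s outer x≢w with group x ≟F group w
  ... | yes g≡ = separated-within-group s outer x≢w g≡
  ... | no g≢  = separated-across-groups s outer g≢

  outer-radical : ∀ s → β s 2F ≡ 0ℤ → RadIsDiagonal (R s)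
  outer-radical s outer r r∘R≐R _ x w rxw with x ≟F w
  ... | yes _  = refl
  ... | no x≢w =
    let (y , Rswy , ¬Rsxy) = outer-separated s outer x≢w in
    contradiction (trans (sym (r∘R≐R x y)) (any-allFin _ w (cong₂ _∧_ rxw Rswy))) ¬Rsxy

lemma5p2 : (t : ℕ) → 3 ≤ t → (W : Mat (t ℕ.* 4)) →
    IsWeighing (t ℕ.* 4) (4 ℕ.* (t ∸ 1)) W → IsSymmetricMat W → DiagBlocksZero t W →
    IsHigmanian (λ i → sOf (M t W i))
lemma5p2 t 3≤t W weighing W-sym W-dbz =
  association-scheme , R-symmetric , 1F , 2F ,
  parabolic row 1F B₁≡δ e₀ e₀⇔same-row ,
  parabolic group 2F B₂≡δ e₁ e₁⇔same-group ,
  radical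
  where
  open Scheme (ℕP.<⇒≤ 3≤t) weighing W-sym W-dbz
  radical : ∀ s → ¬ (R s ⊆ e₁) → RadIsDiagonal (R s)
  radical 0F R⊈e₁ = contradiction (inner⊆e₁ 0F refl) R⊈e₁
  radical 1F R⊈e₁ = contradiction (inner⊆e₁ 1F refl) R⊈e₁
  radical 2F R⊈e₁ = contradiction (inner⊆e₁ 2F refl) R⊈e₁
  radical 3F _    = outer-radical 3F refl
  radical 4F _    = outer-radical 4F refl
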